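{- Let $\Gamma$ be a finite connected $(G,s)$-geodesic-transitive digraph for some integer $s\geq 2$, where $G\leq\mathrm{Aut}(\Gamma)$, and let $N$ be a normal subgroup of $G$ with at least $3$ orbits on $V(\Gamma)$. Then the quotient $\Gamma_N$ is either directed (its arc relation is antisymmetric) or an undirected complete graph.
   Context: A digraph $\Gamma$ consists of a finite vertex set $V(\Gamma)$ with an antisymmetric irreflexive relation $\rightarrow$; an arc is an ordered pair $(u,v)$ with $u\rightarrow v$. Connected means the underlying undirected graph is connected. The distance $d_\Gamma(u,v)$ is the length of a shortest directed path from $u$ to $v$. An $s$-arc is a sequence $(v_0,\dots,v_s)$ with $v_i\rightarrow v_{i+1}$ for all $i$; it is an $s$-geodesic if $d_\Gamma(v_0,v_s)=s$. $\Gamma$ is $(G,s)$-geodesic-transitive if $G$ is transitive on the set of $i$-geodesics for each $i\leq s$. The quotient $\Gamma_N$ has as vertices the $N$-orbits on $V(\Gamma)$, with $(A,B)$ an arc iff some $a\in A$, $b\in B$ satisfy $a\rightarrow b$; if both $(A,B)$ and $(B,A)$ are arcs this is an undirected edge. -}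

module Defs where

open import Data.Nat using (ℕ; suc; _<_; _≤_)
open import Data.Fin using (Fin)
open import Data.Bool using (Bool; T)
open import Data.Unit using (⊤)
open import Data.Product using (_×_; ∃; Σ)
open import Data.Sum using (_⊎_)
open import Data.Vec using (Vec; []; _∷_; head; last; map)
open import Data.List using (List)
open import Data.List.Relation.Unary.Any using (Any)
open import Data.List.Relation.Unary.All using (All)
open import Data.Fin.Permutation using (Permutation′; _⟨$⟩ʳ_; _∘ₚ_; flip; _≈_)
  renaming (id to idₚ)
open import Relation.Nullary using (¬_)
open import Relation.Binary.PropositionalEquality using (_≡_)
open import Relation.Binary.Construct.Closure.Symmetric using (SymClosure)
open import Relation.Binary.Construct.Closure.ReflexiveTransitive using (Star)

Adj : ℕ → Set
Adj n = Fin n → Fin n → Bool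

module _ {n : ℕ} (adj : Adj n) where

  Arc : Fin n → Fin n → Set
  Arc u v = T (adj u v)

  IsDigraph : Set
  IsDigraph = (∀ u → ¬ Arc u u) × (∀ u v → Arc u v → ¬ Arc v u)

  Connected : Set
  Connected = ∀ u v → Star (SymClosure Arc) u v

  IsArcSeq : ∀ {k} → Vec (Fin n) (suc k) → Set
  IsArcSeq (x ∷ []) = ⊤
  IsArcSeq (x ∷ y ∷ xs) = Arc x y × IsArcSeq (y ∷ xs)

  PathOfLength : ℕ → Fin n → Fin n → Set
  PathOfLength k u v =
    Σ (Vec (Fin n) (suc k)) λ p → IsArcSeq p × head p ≡ u × last p ≡ v

  IsGeodesic : ∀ {i} → Vec (Fin n) (suc i) → Set
  IsGeodesic {i} p = IsArcSeq p × (∀ k → k < i → ¬ PathOfLength k (head p) (last p))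

  IsAut : Permutation′ n → Set
  IsAut g = ∀ u v → adj u v ≡ adj (g ⟨$⟩ʳ u) (g ⟨$⟩ʳ v)

-- a finite set of permutations, given as a list; membership up to pointwise equality
_∈ₚ_ : ∀ {n} → Permutation′ n → List (Permutation′ n) → Set
g ∈ₚ L = Any (λ h → h ≈ g) L

IsPermGroup : ∀ {n} → List (Permutation′ n) → Set
IsPermGroup L = (idₚ ∈ₚ L)
  × (∀ g h → g ∈ₚ L → h ∈ₚ L → (g ∘ₚ h) ∈ₚ L)
  × (∀ g → g ∈ₚ L → flip g ∈ₚ L)

IsAutGroup : ∀ {n} → Adj n → List (Permutation′ n) → Set
IsAutGroup adj G = IsPermGroup G × All (IsAut adj) G

IsNormalSubgroup : ∀ {n} → List (Permutation′ n) → List (Permutation′ n) → Set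
IsNormalSubgroup N G = IsPermGroup N
  × (∀ h → h ∈ₚ N → h ∈ₚ G)
  × (∀ g h → g ∈ₚ G → h ∈ₚ N → (flip g ∘ₚ h ∘ₚ g) ∈ₚ N)

GeodesicTransitive : ∀ {n} → Adj n → List (Permutation′ n) → ℕ → Set
GeodesicTransitive {n} adj G s = ∀ i → i ≤ s → (p q : Vec (Fin n) (suc i))
  → IsGeodesic adj p → IsGeodesic adj q
  → ∃ λ g → g ∈ₚ G × map (g ⟨$⟩ʳ_) p ≡ q

module _ {n : ℕ} (adj : Adj n) (N : List (Permutation′ n)) where

  SameOrbit : Fin n → Fin n → Set
  SameOrbit u v = ∃ λ h → h ∈ₚ N × h ⟨$⟩ʳ u ≡ v

  AtLeast3Orbits : Set
  AtLeast3Orbits = ∃ λ u → ∃ λ v → ∃ λ w →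
    ¬ SameOrbit u v × ¬ SameOrbit u w × ¬ SameOrbit v w

  -- arc of the quotient Γ_N between (distinct) orbits represented by A and B
  QArc : Fin n → Fin n → Set
  QArc A B = ¬ SameOrbit A B × ∃ λ a → ∃ λ b →
    SameOrbit A a × SameOrbit B b × Arc adj a b

  QuotientDirected : Set
  QuotientDirected = ∀ A B → QArc A B → ¬ QArc B A

  QuotientCompleteUndirected : Set
  QuotientCompleteUndirected = ∀ A B → ¬ SameOrbit A B → QArc A B × QArc B A

-- Suppose Γ_N is not directed, so some arc a → b is followed by an arc b → a′ with
-- a′ in the N-orbit of a. If a → a′, arc-transitivity puts every arc inside an
-- N-orbit and connectivity forces a single orbit. Otherwise (a, b, a′) is a
-- 2-geodesic, and geodesic-transitivity gives: every arc x → y is followed by an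
-- arc back into the orbit of x, and the ends of every 2-arc lie in one orbit or are
-- adjacent. Hence quotient adjacency is symmetric and transitive on distinct
-- orbits, and connectivity makes Γ_N complete.
module Submission where

open import Defs
open import Data.Nat using (ℕ; zero; suc; _≤_; _<_; s≤s; z≤n)
open import Data.Nat.Properties using (≤-trans)
open import Data.Fin using (Fin; _≟_)
open import Data.Fin.Properties using (any?)
open import Data.Fin.Permutation
  using (Permutation′; _⟨$⟩ʳ_; _∘ₚ_; flip; inverseˡ) renaming (id to idₚ)
open import Data.Bool using (T)
open import Data.Bool.Properties using (T?)
open import Data.Unit using (tt)
open import Data.List using (List)
import Data.List.Relation.Unary.Any as Any
open import Data.List.Relation.Unary.All as All using (All)
open import Data.List.Membership.Propositional using (find)
open import Data.Product using (_×_; ∃; ∃₂; _,_; proj₁; proj₂)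
open import Data.Sum using (_⊎_; inj₁; inj₂; [_,_]′)
open import Data.Vec using ([]; _∷_; head; tail)
open import Function using (_∘_)
open import Relation.Nullary using (¬_; Dec; yes; no; contradiction)
open import Relation.Nullary.Decidable using (_×-dec_; map′)
open import Relation.Binary.PropositionalEquality
  using (_≡_; _≢_; refl; trans; cong; cong₂; subst)
open import Relation.Binary.Construct.Closure.Symmetric as SymClosure using (SymClosure)
open import Relation.Binary.Construct.Closure.ReflexiveTransitive as Star using (Star)

∈ₚ-isAut : ∀ {n} (adj : Adj n) {G : List (Permutation′ n)} →
           All (IsAut adj) G → ∀ g → g ∈ₚ G → IsAut adj g
∈ₚ-isAut adj auts g g∈G u v with All.lookupAny auts g∈G
... | isAut , h≈g = trans (isAut u v) (cong₂ adj (h≈g u) (h≈g v))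

isAut-preserves-Arc : ∀ {n} (adj : Adj n) g → IsAut adj g →
                      ∀ {u v} → Arc adj u v → Arc adj (g ⟨$⟩ʳ u) (g ⟨$⟩ʳ v)
isAut-preserves-Arc adj g isAut {u} {v} = subst T (isAut u v)

sameOrbit? : ∀ {n} (adj : Adj n) (N : List (Permutation′ n)) →
             ∀ u v → Dec (SameOrbit adj N u v)
sameOrbit? adj N u v =
  map′ fromAny toAny (Any.any? (λ h → h ⟨$⟩ʳ u ≟ v) N)
  where
  fromAny : Any.Any (λ h → h ⟨$⟩ʳ u ≡ v) N → SameOrbit adj N u v
  fromAny p with find p
  ... | h , h∈N , hu≡v = h , Any.map (λ { refl _ → refl }) h∈N , hu≡v

  toAny : SameOrbit adj N u v → Any.Any (λ h → h ⟨$⟩ʳ u ≡ v) N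
  toAny (h , h∈N , hu≡v) = Any.map (λ h′≈h → trans (h′≈h u) hu≡v) h∈N

module OrbitEquivalence {n} (adj : Adj n) (N : List (Permutation′ n))
                        (N-isPermGroup : IsPermGroup N) where

  private
    _~_ : Fin n → Fin n → Set
    _~_ = SameOrbit adj N

  ~-refl : ∀ {u} → u ~ u
  ~-refl = idₚ , proj₁ N-isPermGroup , refl

  ~-sym : ∀ {u v} → u ~ v → v ~ u
  ~-sym (h , h∈N , refl) = flip h , proj₂ (proj₂ N-isPermGroup) h h∈N , inverseˡ h

  ~-trans : ∀ {u v w} → u ~ v → v ~ w → u ~ w
  ~-trans (h , h∈N , refl) (k , k∈N , refl) =
    h ∘ₚ k , proj₁ (proj₂ N-isPermGroup) h k h∈N k∈N , refl

  Star-⊆-~ : (∀ {x y} → Arc adj x y → x ~ y) →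
             ∀ {u v} → Star (SymClosure (Arc adj)) u v → u ~ v
  Star-⊆-~ arc⊆~ = Star.fold _~_ (~-trans ∘ SymClosure.fold ~-sym arc⊆~) ~-refl

module _ {n} {adj : Adj n} (isDigraph : IsDigraph adj) where

  arc-isGeodesic : ∀ {x y} → Arc adj x y → IsGeodesic adj (x ∷ y ∷ [])
  arc-isGeodesic {x} {y} x→y = (x→y , tt) , noShorter
    where
    noShorter : ∀ k → k < 1 → ¬ PathOfLength adj k x y
    noShorter zero _ ((_ ∷ []) , _ , refl , refl) = proj₁ isDigraph x x→y
    noShorter (suc _) (s≤s ()) _

  2-arc-isGeodesic : ∀ {x z y} → Arc adj x z → Arc adj z y →
                     x ≢ y → ¬ Arc adj x y → IsGeodesic adj (x ∷ z ∷ y ∷ [])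
  2-arc-isGeodesic {x} {z} {y} x→z z→y x≢y x↛y = (x→z , z→y , tt) , noShorter
    where
    noShorter : ∀ k → k < 2 → ¬ PathOfLength adj k x y
    noShorter zero _ ((_ ∷ []) , _ , refl , x≡y) = x≢y x≡y
    noShorter (suc zero) _ ((_ ∷ _ ∷ []) , (x→y , tt) , refl , refl) = x↛y x→y
    noShorter (suc (suc _)) (s≤s (s≤s ())) _

OrbitArc : ∀ {n} → Adj n → List (Permutation′ n) → Fin n → Fin n → Set
OrbitArc adj N X Y = ∃₂ λ x y → SameOrbit adj N X x × SameOrbit adj N Y y × Arc adj x y

Reversal : ∀ {n} → Adj n → List (Permutation′ n) → Set
Reversal adj N = ∃ λ a → ∃ λ b → ∃ λ a′ → Arc adj a b × Arc adj b a′ × SameOrbit adj N a a′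

reversal? : ∀ {n} (adj : Adj n) (N : List (Permutation′ n)) → Dec (Reversal adj N)
reversal? adj N = any? λ a → any? λ b → any? λ a′ →
  T? (adj a b) ×-dec T? (adj b a′) ×-dec sameOrbit? adj N a a′

module GeodesicTransitiveQuotient
  {n} (adj : Adj n) (G N : List (Permutation′ n)) {s} (2≤s : 2 ≤ s)
  (isDigraph : IsDigraph adj) (isAutGroup : IsAutGroup adj G)
  (geodesicTransitive : GeodesicTransitive adj G s) (isNormal : IsNormalSubgroup N G)
  where

  private
    _~_ : Fin n → Fin n → Set
    _~_ = SameOrbit adj N
    _→′_ : Fin n → Fin n → Set
    _→′_ = Arc adj

  open OrbitEquivalence adj N (proj₁ isNormal)

  preserves-Arc : ∀ g → g ∈ₚ G → ∀ {u v} → u →′ v → (g ⟨$⟩ʳ u) →′ (g ⟨$⟩ʳ v)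
  preserves-Arc g g∈G = isAut-preserves-Arc adj g (∈ₚ-isAut adj (proj₂ isAutGroup) g g∈G)

  preserves-~ : ∀ g → g ∈ₚ G → ∀ {u v} → u ~ v → (g ⟨$⟩ʳ u) ~ (g ⟨$⟩ʳ v)
  preserves-~ g g∈G (h , h∈N , refl) =
    flip g ∘ₚ h ∘ₚ g , proj₂ (proj₂ isNormal) g h g∈G h∈N ,
    cong (λ x → g ⟨$⟩ʳ (h ⟨$⟩ʳ x)) (inverseˡ g)

  transport-Arc : ∀ {x x′ y} → x ~ x′ → x →′ y → ∃ λ y′ → y ~ y′ × x′ →′ y′
  transport-Arc (h , h∈N , refl) x→y =
    _ , (h , h∈N , refl) , preserves-Arc h (proj₁ (proj₂ isNormal) h h∈N) x→y

  arc-transitive : ∀ {a b x y} → a →′ b → x →′ y →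
                   ∃ λ g → g ∈ₚ G × g ⟨$⟩ʳ a ≡ x × g ⟨$⟩ʳ b ≡ y
  arc-transitive {a} {b} {x} {y} a→b x→y
    with geodesicTransitive 1 (≤-trans (s≤s z≤n) 2≤s) (a ∷ b ∷ []) (x ∷ y ∷ [])
           (arc-isGeodesic isDigraph a→b) (arc-isGeodesic isDigraph x→y)
  ... | g , g∈G , ga≡x = g , g∈G , cong head ga≡x , cong (head ∘ tail) ga≡x

  arc-inside-orbit : ∀ {a a′} → a →′ a′ → a ~ a′ → ∀ {x y} → x →′ y → x ~ y
  arc-inside-orbit a→a′ a~a′ x→y with arc-transitive a→a′ x→y
  ... | g , g∈G , refl , refl = preserves-~ g g∈G a~a′

  module NonDegenerateReversal {a b a′} (a→b : a →′ b) (b→a′ : b →′ a′)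
                               (a~a′ : a ~ a′) (a↛a′ : ¬ a →′ a′) where

    arc-reversible : ∀ {x y} → x →′ y → ∃ λ x′ → x ~ x′ × y →′ x′
    arc-reversible x→y with arc-transitive a→b x→y
    ... | g , g∈G , refl , refl = _ , preserves-~ g g∈G a~a′ , preserves-Arc g g∈G b→a′

    2-geodesic-ends-~ : ∀ {x z y} → IsGeodesic adj (x ∷ z ∷ y ∷ []) → x ~ y
    2-geodesic-ends-~ {x} {z} {y} geodesic
      with geodesicTransitive 2 2≤s (a ∷ b ∷ a′ ∷ []) (x ∷ z ∷ y ∷ [])
             (2-arc-isGeodesic isDigraph a→b b→a′ a≢a′ a↛a′) geodesic
      where
      a≢a′ : a ≢ a′
      a≢a′ refl = proj₂ isDigraph a b a→b b→a′
    ... | g , g∈G , ga≡x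
      with cong head ga≡x | cong (head ∘ tail ∘ tail) ga≡x
    ... | refl | refl = preserves-~ g g∈G a~a′

    2-arc-ends : ∀ {x z y} → x →′ z → z →′ y → x ~ y ⊎ x →′ y
    2-arc-ends {x} {z} {y} x→z z→y with T? (adj x y) | x ≟ y
    ... | yes x→y | _        = inj₂ x→y
    ... | no _    | yes refl = inj₁ ~-refl
    ... | no x↛y  | no x≢y   = inj₁ (2-geodesic-ends-~ (2-arc-isGeodesic isDigraph x→z z→y x≢y x↛y))

    OrbitArc-sym : ∀ {X Y} → OrbitArc adj N X Y → OrbitArc adj N Y X
    OrbitArc-sym (x , y , X~x , Y~y , x→y) with arc-reversible x→y
    ... | x′ , x~x′ , y→x′ = y , x′ , Y~y , ~-trans X~x x~x′ , y→x′

    OrbitArc-step : ∀ {U V W} → OrbitArc adj N U V → OrbitArc adj N V W →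
                    U ~ W ⊎ OrbitArc adj N U W
    OrbitArc-step {W = W} (x , z , U~x , V~z , x→z) (z′ , y , V~z′ , W~y , z′→y)
      with transport-Arc (~-trans (~-sym V~z′) V~z) z′→y
    ... | y′ , y~y′ , z→y′ =
      [ (λ x~y′ → inj₁ (~-trans U~x (~-trans x~y′ (~-sym W~y′))))
      , (λ x→y′ → inj₂ (x , y′ , U~x , W~y′ , x→y′)) ]′ (2-arc-ends x→z z→y′)
      where
      W~y′ : W ~ y′
      W~y′ = ~-trans W~y y~y′

    Star-⇒-OrbitArc : ∀ {U W} → Star (SymClosure _→′_) U W → U ~ W ⊎ OrbitArc adj N U W
    Star-⇒-OrbitArc = Star.fold _ extend (inj₁ ~-refl)
      where
      edge : ∀ {U V} → SymClosure _→′_ U V → OrbitArc adj N U V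
      edge = SymClosure.fold OrbitArc-sym (λ u→v → _ , _ , ~-refl , ~-refl , u→v)

      extend : ∀ {U V W} → SymClosure _→′_ U V → V ~ W ⊎ OrbitArc adj N V W →
               U ~ W ⊎ OrbitArc adj N U W
      extend e (inj₁ V~W) with edge e
      ... | x , y , U~x , V~y , x→y = inj₂ (x , y , U~x , ~-trans (~-sym V~W) V~y , x→y)
      extend e (inj₂ V→W) = OrbitArc-step (edge e) V→W

    quotient-complete : Connected adj → QuotientCompleteUndirected adj N
    quotient-complete connected X Y X≁Y with Star-⇒-OrbitArc (connected X Y)
    ... | inj₁ X~Y = contradiction X~Y X≁Y
    ... | inj₂ X→Y = (X≁Y , X→Y) , (X≁Y ∘ ~-sym , OrbitArc-sym X→Y)

  no-reversal⇒directed : ¬ Reversal adj N → QuotientDirected adj N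
  no-reversal⇒directed ¬reversal X Y
    (_ , a , b , X~a , Y~b , a→b) (_ , b′ , a′ , Y~b′ , X~a′ , b′→a′)
    with transport-Arc (~-trans (~-sym Y~b′) Y~b) b′→a′
  ... | a″ , a′~a″ , b→a″ = ¬reversal (a , b , a″ , a→b , b→a″ ,
                              ~-trans (~-sym X~a) (~-trans X~a′ a′~a″))

  directed-or-complete : Connected adj → ∀ {u v} → ¬ u ~ v →
                         QuotientDirected adj N ⊎ QuotientCompleteUndirected adj N
  directed-or-complete connected {u} {v} u≁v with reversal? adj N
  ... | no ¬reversal = inj₁ (no-reversal⇒directed ¬reversal)
  ... | yes (a , b , a′ , a→b , b→a′ , a~a′) with T? (adj a a′)
  ...   | yes a→a′ = contradiction (Star-⊆-~ (arc-inside-orbit a→a′ a~a′) (connected u v)) u≁v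
  ...   | no a↛a′  = inj₂ (NonDegenerateReversal.quotient-complete a→b b→a′ a~a′ a↛a′ connected)

-- Only two distinct N-orbits are needed.
lemma3p3 : (n : ℕ) (adj : Adj n) (G N : List (Permutation′ n)) (s : ℕ)
    → 2 ≤ s
    → IsDigraph adj
    → Connected adj
    → IsAutGroup adj G
    → GeodesicTransitive adj G s
    → IsNormalSubgroup N G
    → AtLeast3Orbits adj N
    → QuotientDirected adj N ⊎ QuotientCompleteUndirected adj N
lemma3p3 n adj G N s 2≤s isDigraph connected isAutGroup geodesicTransitive isNormal
         (_ , _ , _ , u≁v , _) =
  GeodesicTransitiveQuotient.directed-or-complete
    adj G N 2≤s isDigraph isAutGroup geodesicTransitive isNormal connected u≁v
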